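{- Let $G$ be a graph and let $r, t \in \mathbb{N}$. Let $A_1, \ldots, A_r, B \subset V(G)$ be disjoint sets with $|B| \geqslant 2^{rt}$ and $A_j \to B$ for each $j \in [r]$. Then there exist subsets $A'_j \subset A_j$ ($j \in [r]$) and $B' \subset B$ such that $B' \to \bigcup_j A'_j$ and $|A'_j| = t$ for each $j \in [r]$.
   Context: For sets of vertices $X, Y$ of a graph $G$, $X \to Y$ ("$X$ shatters $Y$") means that for every subset $S \subseteq Y$ there is a vertex $x \in X$ with $\Gamma(x) \cap Y = S$, where $\Gamma(x)$ denotes the neighbourhood of $x$. -}

module Defs where

open import Data.Nat using (ℕ; _≥_; _^_; _*_)
open import Data.Fin using (Fin)
open import Data.Fin.Subset using (Subset; _∈_; _∉_; _⊆_; ∣_∣)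
open import Data.Product using (Σ; _×_; ∃)
open import Function.Bundles using (_⇔_)
open import Relation.Binary.PropositionalEquality using (_≢_)
open import Relation.Nullary using (¬_)
open import Level using (0ℓ; suc)

record Graph (n : ℕ) : Set₁ where
  field
    Adj     : Fin n → Fin n → Set
    sym     : ∀ {x y} → Adj x y → Adj y x
    irrefl  : ∀ {x} → ¬ Adj x x

-- X shatters Y: for every S ⊆ Y there is x ∈ X with Γ(x) ∩ Y = S.
Shatters : ∀ {n} → Graph n → Subset n → Subset n → Set
Shatters G X Y =
  (S : Subset _) → S ⊆ Y →
  Σ (Fin _) λ x → x ∈ X ×
    ((y : Fin _) → y ∈ Y → (Graph.Adj G x y ⇔ y ∈ S))

Disjoint : ∀ {n} → Subset n → Subset n → Set
Disjoint X Y = ∀ v → v ∈ X → v ∉ Y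

_∈⋃_ : ∀ {n r} → Fin n → (Fin r → Subset n) → Set
v ∈⋃ A = ∃ λ j → v ∈ A j

ShattersUnion : ∀ {n r} → Graph n → Subset n → (Fin r → Subset n) → Set
ShattersUnion G X A =
  (S : Subset _) → (∀ y → y ∈ S → y ∈⋃ A) →
  Σ (Fin _) λ x → x ∈ X ×
    ((y : Fin _) → y ∈⋃ A → (Graph.Adj G x y ⇔ y ∈ S))

module Submission where

-- Put m = r·t and index the t vertices wanted from each A j
-- by the coordinates c = combine j k of Fin m.  Since |B| ≥ 2^m we can pick
-- distinct vertices b w ∈ B, one for every binary pattern w ∈ Fin (2^m)
-- (read as a function Fin m → Fin 2 via finToFun).  For a coordinate c,
-- the set of b w with c marked in w is a subset of B, so the shattering
-- set A j (j the block of c) contains a vertex a c adjacent to exactly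
-- those b w.  Such a "crossing" pair (a, b) is automatically injective in
-- a, and b shatters the image of a: to cut out T, take the pattern marking
-- those c with a c ∈ T.  Hence A′ j = {a (combine j k) | k} has t elements
-- and B′ = B shatters ⋃ A′ j.

open import Defs
open import Data.Nat using (ℕ; zero; suc; _≥_; _^_; _*_)
open import Data.Fin using (Fin; zero; suc; inject≤; combine; quotient; finToFun; funToFin)
open import Data.Fin.Properties
  using (_≟_; any?; suc-injective; inject≤-injective; combine-injectiveʳ; remQuot-combine; finToFun-funToFin)
open import Data.Fin.Subset using (Subset; inside; outside; _∈_; _∉_; _⊆_; ∣_∣; ⊥; ⁅_⁆; _∪_)
open import Data.Fin.Subset.Properties
  using (_∈?_; ∉⊥; x∈⁅x⁆; x∈⁅y⁆⇒x≡y; x∈p∪q⁺; x∈p∪q⁻; ∣⊥∣≡0; ∪-identityˡ)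
open import Data.Vec using (_∷_; lookup; tabulate; here; there)
open import Data.Vec.Properties using (lookup∘tabulate; []=⇒lookup; lookup⇒[]=)
open import Data.Product using (Σ; _×_; _,_; proj₁; proj₂; ∃)
open import Data.Sum using (inj₁; inj₂)
open import Data.Empty using (⊥-elim)
open import Function using (id; _∘_)
open import Function.Bundles using (_⇔_; mk⇔; Equivalence)
import Function.Properties.Equivalence as ⇔
open import Relation.Nullary using (Dec; yes; no; does; _×-dec_)
open import Level using (0ℓ)
open import Relation.Unary using (Pred; Decidable)
open import Relation.Binary.PropositionalEquality
  using (_≡_; _≢_; refl; sym; trans; cong; subst)

open Equivalence using (to; from)

Injective : ∀ {m n} → (Fin m → Fin n) → Set
Injective f = ∀ i j → f i ≡ f j → i ≡ j

element : ∀ {n} (p : Subset n) → Fin ∣ p ∣ → Fin n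
element (outside ∷ p) i       = suc (element p i)
element (inside  ∷ p) zero    = zero
element (inside  ∷ p) (suc i) = suc (element p i)

element∈ : ∀ {n} (p : Subset n) (i : Fin ∣ p ∣) → element p i ∈ p
element∈ (outside ∷ p) i       = there (element∈ p i)
element∈ (inside  ∷ p) zero    = here
element∈ (inside  ∷ p) (suc i) = there (element∈ p i)

element-injective : ∀ {n} (p : Subset n) → Injective (element p)
element-injective (outside ∷ p) i j eq = element-injective p i j (suc-injective eq)
element-injective (inside  ∷ p) zero    zero    eq = refl
element-injective (inside  ∷ p) (suc i) (suc j) eq =
  cong suc (element-injective p i j (suc-injective eq))

injectInto : ∀ {n k} (p : Subset n) → ∣ p ∣ ≥ k →
  Σ (Fin k → Fin n) λ f → (∀ i → f i ∈ p) × Injective f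
injectInto p k≤∣p∣ =
  element p ∘ (λ i → inject≤ i k≤∣p∣) ,
  (λ i → element∈ p _) ,
  (λ i j eq → inject≤-injective k≤∣p∣ k≤∣p∣ i j (element-injective p _ _ eq))

⟦_⟧ : ∀ {n} {P : Pred (Fin n) 0ℓ} → Decidable P → Subset n
⟦ P? ⟧ = tabulate (does ∘ P?)

∈⟦⟧⇔ : ∀ {n} {P : Pred (Fin n) 0ℓ} (P? : Decidable P) {y : Fin n} → y ∈ ⟦ P? ⟧ ⇔ P y
∈⟦⟧⇔ {P = P} P? {y} = mk⇔ (toP (P? y) bit) (fromP (P? y) bit)
  where
  bit : lookup ⟦ P? ⟧ y ≡ does (P? y)
  bit = lookup∘tabulate (does ∘ P?) y
  toP : (d : Dec (P y)) → lookup ⟦ P? ⟧ y ≡ does d → y ∈ ⟦ P? ⟧ → P y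
  toP (yes p) _  _   = p
  toP (no ¬p) eq y∈ with trans (sym ([]=⇒lookup y∈)) eq
  ... | ()
  fromP : (d : Dec (P y)) → lookup ⟦ P? ⟧ y ≡ does d → P y → y ∈ ⟦ P? ⟧
  fromP (yes _) eq _ = lookup⇒[]= y _ eq
  fromP (no ¬p) _  p = ⊥-elim (¬p p)

image : ∀ {t n} → (Fin t → Fin n) → Subset n
image {zero}  f = ⊥
image {suc t} f = ⁅ f zero ⁆ ∪ image (f ∘ suc)

∈image⇔ : ∀ {t n} (f : Fin t → Fin n) {y : Fin n} → y ∈ image f ⇔ ∃ λ k → f k ≡ y
∈image⇔ f = mk⇔ (image⁻ f) (λ { (k , refl) → image⁺ f k })
  where
  image⁺ : ∀ {t n} (f : Fin t → Fin n) k → f k ∈ image f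
  image⁺ f zero    = x∈p∪q⁺ (inj₁ (x∈⁅x⁆ _))
  image⁺ f (suc k) = x∈p∪q⁺ (inj₂ (image⁺ (f ∘ suc) k))
  image⁻ : ∀ {t n} (f : Fin t → Fin n) {y} → y ∈ image f → ∃ λ k → f k ≡ y
  image⁻ {zero}  f y∈ = ⊥-elim (∉⊥ y∈)
  image⁻ {suc t} f y∈ with x∈p∪q⁻ _ _ y∈
  ... | inj₁ y∈⁅f0⁆ = zero , sym (x∈⁅y⁆⇒x≡y _ y∈⁅f0⁆)
  ... | inj₂ y∈rest with image⁻ (f ∘ suc) y∈rest
  ...   | k , eq = suc k , eq

∣⁅x⁆∪p∣ : ∀ {n} (x : Fin n) (p : Subset n) → x ∉ p → ∣ ⁅ x ⁆ ∪ p ∣ ≡ suc ∣ p ∣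
∣⁅x⁆∪p∣ zero    (outside ∷ p) _   = cong suc (cong ∣_∣ (∪-identityˡ p))
∣⁅x⁆∪p∣ zero    (inside  ∷ p) x∉p = ⊥-elim (x∉p here)
∣⁅x⁆∪p∣ (suc x) (outside ∷ p) x∉p = ∣⁅x⁆∪p∣ x p (x∉p ∘ there)
∣⁅x⁆∪p∣ (suc x) (inside  ∷ p) x∉p = cong suc (∣⁅x⁆∪p∣ x p (x∉p ∘ there))

∣image∣ : ∀ {t n} (f : Fin t → Fin n) → Injective f → ∣ image f ∣ ≡ t
∣image∣ {zero}  {n} f _   = ∣⊥∣≡0 n
∣image∣ {suc t}     f inj =
  trans (∣⁅x⁆∪p∣ (f zero) (image (f ∘ suc)) fresh)
        (cong suc (∣image∣ (f ∘ suc) (λ i j → suc-injective ∘ inj (suc i) (suc j))))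
  where
  fresh : f zero ∉ image (f ∘ suc)
  fresh f0∈ with to (∈image⇔ (f ∘ suc)) f0∈
  ... | k , eq with inj (suc k) zero eq
  ...   | ()

-- Binary patterns are the elements of Fin (2 ^ m), read as maps
-- Fin m → Fin 2 via finToFun; `on` is the marking value.
on : Fin 2
on = suc zero

Marked : ∀ {m} → Fin (2 ^ m) → Fin m → Set
Marked w c = finToFun w c ≡ on

marked? : ∀ {m} (w : Fin (2 ^ m)) (c : Fin m) → Dec (Marked w c)
marked? w c = finToFun w c ≟ on

indicator : ∀ {P : Set} → Dec P → Fin 2
indicator (yes _) = on
indicator (no _)  = zero

indicator⇔ : ∀ {P : Set} (d : Dec P) → indicator d ≡ on ⇔ P
indicator⇔ (yes p) = mk⇔ (λ _ → p) (λ _ → refl)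
indicator⇔ (no ¬p) = mk⇔ (λ ()) (λ p → ⊥-elim (¬p p))

realise : ∀ {m} {P : Pred (Fin m) 0ℓ} → Decidable P → Σ (Fin (2 ^ m)) λ w → ∀ c → Marked w c ⇔ P c
realise P? = funToFin (indicator ∘ P?) , λ c →
  ⇔.trans (≡on⇔ (finToFun-funToFin (indicator ∘ P?) c)) (indicator⇔ (P? c))
  where
  ≡on⇔ : ∀ {x y : Fin 2} → x ≡ y → x ≡ on ⇔ y ≡ on
  ≡on⇔ refl = ⇔.refl

module _ {n : ℕ} (G : Graph n) where
  open Graph G renaming (sym to adj-sym)

  Crossing : ∀ {m} → (Fin m → Fin n) → (Fin (2 ^ m) → Fin n) → Set
  Crossing a b = ∀ c w → Adj (a c) (b w) ⇔ Marked w c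

  -- If each X c shatters B and b injects all patterns into B, then
  -- there are vertices a c ∈ X c crossing b: a c realises {b w | w marks c}.
  crossing-exists : ∀ {m : ℕ} (B : Subset n) (b : Fin (2 ^ m) → Fin n) →
    (∀ w → b w ∈ B) → Injective b →
    (X : Fin m → Subset n) → (∀ c → Shatters G (X c) B) →
    Σ (Fin m → Fin n) λ a → (∀ c → a c ∈ X c) × Crossing a b
  crossing-exists {m} B b b∈B b-inj X shatters =
    (λ c → proj₁ (witness c)) , (λ c → proj₁ (proj₂ (witness c))) , crossing
    where
    Codes : Fin m → Pred (Fin n) 0ℓ
    Codes c y = ∃ λ w → b w ≡ y × Marked w c
    coded? : ∀ c → Decidable (Codes c)
    coded? c y = any? (λ w → (b w ≟ y) ×-dec marked? w c)
    S : Fin m → Subset n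
    S c = ⟦ coded? c ⟧
    S⊆B : ∀ c → S c ⊆ B
    S⊆B c y∈ with to (∈⟦⟧⇔ {P = Codes c} (coded? c)) y∈
    ... | w , refl , _ = b∈B w
    witness : ∀ c → Σ (Fin n) λ x → x ∈ X c × ((y : Fin n) → y ∈ B → (Adj x y ⇔ y ∈ S c))
    witness c = shatters c (S c) (S⊆B c)
    coded⇔ : ∀ c w → b w ∈ S c ⇔ Marked w c
    coded⇔ c w = ⇔.trans (∈⟦⟧⇔ {P = Codes c} (coded? c)) (mk⇔
      (λ { (w′ , eq , marked) → subst (λ v → Marked v c) (b-inj w′ w eq) marked })
      (λ marked → w , refl , marked))
    crossing : Crossing (λ c → proj₁ (witness c)) b
    crossing c w = ⇔.trans (proj₂ (proj₂ (witness c)) (b w) (b∈B w)) (coded⇔ c w)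

  -- Distinct coordinates give distinct crossing vertices: the pattern
  -- marking only c separates a c from every other a c′.
  crossing-injective : ∀ {m} {a : Fin m → Fin n} {b} → Crossing a b → Injective a
  crossing-injective {m} {a} {b} cross c c′ eq = to (onlyC c′) marked-c′
    where
    only-c : Σ (Fin (2 ^ m)) λ w → ∀ d → Marked w d ⇔ c ≡ d
    only-c = realise (c ≟_)
    w : Fin (2 ^ m)
    w = proj₁ only-c
    onlyC : ∀ d → Marked w d ⇔ c ≡ d
    onlyC = proj₂ only-c
    marked-c′ : Marked w c′
    marked-c′ = to (cross c′ w) (subst (λ v → Adj v (b w)) eq (from (cross c w) (from (onlyC c) refl)))

  -- The b side shatters the a side: any T is cut out by the pattern
  -- marking the coordinates c with a c ∈ T.
  crossing-shatters : ∀ {m} {a : Fin m → Fin n} {b} → Crossing a b →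
    (T : Subset n) → Σ (Fin (2 ^ m)) λ w → ∀ c → Adj (b w) (a c) ⇔ a c ∈ T
  crossing-shatters {m} {a} {b} cross T = w , λ c →
    ⇔.trans (mk⇔ adj-sym adj-sym) (⇔.trans (cross c w) (selects c))
    where
    selection : Σ (Fin (2 ^ m)) λ w → ∀ c → Marked w c ⇔ a c ∈ T
    selection = realise (λ c → a c ∈? T)
    w : Fin (2 ^ m)
    w = proj₁ selection
    selects : ∀ c → Marked w c ⇔ a c ∈ T
    selects = proj₂ selection

-- The theorem.
lemma2 : (n : ℕ) (G : Graph n) (r t : ℕ)
    (A : Fin r → Subset n) (B : Subset n) →
    (∀ i j → i ≢ j → Disjoint (A i) (A j)) →
    (∀ j → Disjoint (A j) B) →
    ∣ B ∣ ≥ 2 ^ (r * t) →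
    (∀ j → Shatters G (A j) B) →
    Σ (Fin r → Subset n) λ A′ → Σ (Subset n) λ B′ →
    (∀ j → A′ j ⊆ A j) × B′ ⊆ B ×
    ShattersUnion G B′ A′ × (∀ j → ∣ A′ j ∣ ≡ t)
lemma2 n G r t A B _ _ bigB shatters = A′ , B , A′⊆A , id , B-shatters , ∣A′∣
  where
  m : ℕ
  m = r * t
  universal : Σ (Fin (2 ^ m) → Fin n) λ b → (∀ w → b w ∈ B) × Injective b
  universal = injectInto B bigB
  b : Fin (2 ^ m) → Fin n
  b = proj₁ universal
  b∈B : ∀ w → b w ∈ B
  b∈B = proj₁ (proj₂ universal)
  -- coordinate c = combine j k is realised inside the block A j
  crossed : Σ (Fin m → Fin n) λ â → (∀ c → â c ∈ A (quotient t c)) × Crossing G â b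
  crossed = crossing-exists G B b b∈B (proj₂ (proj₂ universal))
                            (A ∘ quotient t) (shatters ∘ quotient t)
  â : Fin m → Fin n
  â = proj₁ crossed
  cross : Crossing G â b
  cross = proj₂ (proj₂ crossed)
  a : Fin r → Fin t → Fin n
  a j k = â (combine j k)
  a∈A : ∀ j k → a j k ∈ A j
  a∈A j k = subst (λ p → a j k ∈ A (proj₁ p)) (remQuot-combine j k) (proj₁ (proj₂ crossed) (combine j k))
  A′ : Fin r → Subset n
  A′ j = image (a j)
  A′⊆A : ∀ j → A′ j ⊆ A j
  A′⊆A j y∈ with to (∈image⇔ (a j)) y∈
  ... | k , refl = a∈A j k
  ∣A′∣ : ∀ j → ∣ A′ j ∣ ≡ t
  ∣A′∣ j = ∣image∣ (a j) λ k k′ → combine-injectiveʳ j k j k′ ∘ crossing-injective G cross _ _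
  B-shatters : ShattersUnion G B A′
  B-shatters T _ with crossing-shatters G cross T
  ... | w , cuts = b w , b∈B w , λ { y (j , y∈) → cutsBlock (to (∈image⇔ (a j)) y∈) }
    where
    cutsBlock : ∀ {j y} → ∃ (λ k → a j k ≡ y) → Graph.Adj G (b w) y ⇔ y ∈ T
    cutsBlock {j} (k , refl) = cuts (combine j k)
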